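{- Let $G$ be a $\theta$-graph with root $r$ and edge weights $\gamma,\tau$: it consists of two distinct vertices $r$ and $v$ joined by three internally vertex-disjoint paths $R_{2,3}$, $R_{1,3}$, $R_{1,2}$. Suppose $G$ has a unique cable-trench tree, and that it is obtained from $G$ by deleting an edge $e_1\in R_{2,3}$ and an edge $e_2\in R_{1,3}$. Let $H$ be any graph with root $r_H$ and edge weights $\gamma,\tau$, and let $G\wedge H$ be obtained by identifying $v$ with $r_H$, rooted at $r$. If a cable-trench tree $T$ of $G\wedge H$ satisfies $E(G)\setminus E(T)=\{e_1',e_2'\}$ with $e_1'\in R_{2,3}$ and $e_2'\in R_{1,3}$, then $e_1'=e_1$ and $e_2'=e_2$.
   Context: For a connected rooted graph (root $r$) with edge weights $\gamma,\tau:E\to\mathbb{R}$, the cost of a spanning tree $T$ is $\mathrm{cost}(T)=\sum_{e\in E(T)}\tau(e)+\sum_{w}\sum_{e\in P_T(r,w)}\gamma(e)$, where $P_T(r,w)$ is the unique $r$–$w$ path in $T$; a cable-trench tree is a spanning tree of minimum cost. Every spanning tree of a $\theta$-graph is obtained by deleting one edge from each of two distinct ones of its three $r$–$v$ paths.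
   Formalization: The edge weights γ, τ of both G and H take values in the rationals rather than in ℝ. -}

module Defs where

open import Data.Nat using (ℕ; zero; suc; _+_)
open import Data.Fin using (Fin; zero; suc; _↑ˡ_; _↑ʳ_; splitAt; punchOut; inject₁; _≟_)
open import Data.Bool using (Bool; true; false; not; _∨_; if_then_else_)
open import Data.Product using (Σ; _×_; _,_; ∃; ∃-syntax; map)
open import Data.Sum using (_⊎_; inj₁; inj₂; [_,_])
open import Data.List using (List; []; _∷_; foldr)
open import Data.List.Relation.Unary.Unique.Propositional using (Unique)
open import Data.Rational using (ℚ; 0ℚ; _≤_) renaming (_+_ to _+ℚ_)
open import Relation.Binary.PropositionalEquality using (_≡_)
open import Relation.Nullary using (¬_; yes; no)
open import Relation.Nullary.Decidable using (⌊_⌋)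

-- Vertices are Fin n, edges are Fin m; an (undirected) edge e joins the
-- two endpoints 'ends e' (loops and parallel edges are allowed).

record Graph (n m : ℕ) : Set where
  field
    ends : Fin m → Fin n × Fin n
    root : Fin n
    γ    : Fin m → ℚ
    τ    : Fin m → ℚ

open Graph public

EdgeSet : ℕ → Set
EdgeSet m = Fin m → Bool

module _ {n m : ℕ} (Γ : Graph n m) where

  Joins : Fin m → Fin n → Fin n → Set
  Joins e x z = ends Γ e ≡ (x , z) ⊎ ends Γ e ≡ (z , x)

  data Walk (S : EdgeSet m) : Fin n → Fin n → List (Fin n) → List (Fin m) → Set where
    nil  : ∀ {x} → Walk S x x (x ∷ []) []
    cons : ∀ {x y z vs es e} → S e ≡ true → Joins e x z →
           Walk S z y vs es → Walk S x y (x ∷ vs) (e ∷ es)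

  Path : EdgeSet m → Fin n → Fin n → List (Fin m) → Set
  Path S x y es = Σ (List (Fin n)) λ vs → Walk S x y vs es × Unique vs

  -- A cycle: a nonempty closed walk x → x whose edges are pairwise
  -- distinct and whose vertices (other than the repeated x) are distinct.
  Cycle : EdgeSet m → Set
  Cycle S = Σ (Fin n) λ x → Σ (List (Fin n)) λ vs → Σ (Fin m) λ e → Σ (List (Fin m)) λ es →
            Walk S x x (x ∷ vs) (e ∷ es) × Unique vs × Unique (e ∷ es)

  Connected : EdgeSet m → Set
  Connected S = ∀ (w : Fin n) → Σ (List (Fin n)) λ vs → Σ (List (Fin m)) λ es → Walk S (root Γ) w vs es

  SpanningTree : EdgeSet m → Set
  SpanningTree S = Connected S × ¬ Cycle S

ΣFin : (k : ℕ) → (Fin k → ℚ) → ℚ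
ΣFin zero    f = 0ℚ
ΣFin (suc k) f = f zero +ℚ ΣFin k (λ i → f (suc i))

ΣList : {A : Set} → (A → ℚ) → List A → ℚ
ΣList f = foldr (λ a s → f a +ℚ s) 0ℚ

module _ {n m : ℕ} (Γ : Graph n m) where

  -- IsCost S c : c is the cable-trench cost of the edge set S, i.e.
  --   c = Σ_{e ∈ S} τ e + Σ_w Σ_{e ∈ P_S(r,w)} γ e,
  -- where P_S(r,w) is the (in a tree unique) r–w path in S.
  IsCost : EdgeSet m → ℚ → Set
  IsCost S c = Σ ((w : Fin n) → List (Fin m)) λ P →
    ((w : Fin n) → Path Γ S (root Γ) w (P w)) ×
    c ≡ ΣFin m (λ e → if S e then τ Γ e else 0ℚ) +ℚ ΣFin n (λ w → ΣList (γ Γ) (P w))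

  CableTrench : EdgeSet m → Set
  CableTrench T = SpanningTree Γ T × Σ ℚ λ c → IsCost T c ×
    (∀ (T′ : EdgeSet m) (c′ : ℚ) → SpanningTree Γ T′ → IsCost T′ c′ → c ≤ c′)

  UniqueCableTrench : EdgeSet m → Set
  UniqueCableTrench T = CableTrench T × (∀ T′ → CableTrench T′ → ∀ e → T′ e ≡ T e)

without : {m : ℕ} → Fin m → Fin m → EdgeSet m
without a b e = not (⌊ e ≟ a ⌋ ∨ ⌊ e ≟ b ⌋)

-- θ-graphs.  θ p₁ p₂ p₃ has root r = vertex 0 and v = vertex 1, and three
-- internally vertex-disjoint r–v paths R₂₃, R₁₃, R₁₂ with p₁, p₂, p₃
-- internal vertices (hence suc p₁, suc p₂, suc p₃ edges), respectively.

θV : ℕ → ℕ → ℕ → ℕ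
θV p₁ p₂ p₃ = suc (suc (p₁ + (p₂ + p₃)))

θE : ℕ → ℕ → ℕ → ℕ
θE p₁ p₂ p₃ = suc p₁ + (suc p₂ + suc p₃)

module _ {N : ℕ} (r v : Fin N) where
  tailSeq : (p : ℕ) → (Fin p → Fin N) → Fin (suc p) → Fin N
  tailSeq zero    f zero    = v
  tailSeq (suc p) f zero    = f zero
  tailSeq (suc p) f (suc j) = tailSeq p (λ i → f (suc i)) j

  pathSeq : (p : ℕ) → (Fin p → Fin N) → Fin (suc (suc p)) → Fin N
  pathSeq p f zero    = r
  pathSeq p f (suc j) = tailSeq p f j

  pathEdge : (p : ℕ) → (Fin p → Fin N) → Fin (suc p) → Fin N × Fin N
  pathEdge p f k = pathSeq p f (inject₁ k) , pathSeq p f (suc k)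

module _ (p₁ p₂ p₃ : ℕ) where
  θr θv : Fin (θV p₁ p₂ p₃)
  θr = zero
  θv = suc zero

  int₁ : Fin p₁ → Fin (θV p₁ p₂ p₃)
  int₁ j = suc (suc (j ↑ˡ (p₂ + p₃)))
  int₂ : Fin p₂ → Fin (θV p₁ p₂ p₃)
  int₂ j = suc (suc (p₁ ↑ʳ (j ↑ˡ p₃)))
  int₃ : Fin p₃ → Fin (θV p₁ p₂ p₃)
  int₃ j = suc (suc (p₁ ↑ʳ (p₂ ↑ʳ j)))

  R₂₃ : Fin (suc p₁) → Fin (θE p₁ p₂ p₃)
  R₂₃ k = k ↑ˡ (suc p₂ + suc p₃)
  R₁₃ : Fin (suc p₂) → Fin (θE p₁ p₂ p₃)
  R₁₃ k = suc p₁ ↑ʳ (k ↑ˡ suc p₃)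
  R₁₂ : Fin (suc p₃) → Fin (θE p₁ p₂ p₃)
  R₁₂ k = suc p₁ ↑ʳ (suc p₂ ↑ʳ k)

  θends : Fin (θE p₁ p₂ p₃) → Fin (θV p₁ p₂ p₃) × Fin (θV p₁ p₂ p₃)
  θends e with splitAt (suc p₁) e
  ... | inj₁ k = pathEdge θr θv p₁ int₁ k
  ... | inj₂ e′ with splitAt (suc p₂) e′
  ...   | inj₁ k = pathEdge θr θv p₂ int₂ k
  ...   | inj₂ k = pathEdge θr θv p₃ int₃ k

  θGraph : (γ τ : Fin (θE p₁ p₂ p₃) → ℚ) → Graph (θV p₁ p₂ p₃) (θE p₁ p₂ p₃)
  θGraph γ′ τ′ = record { ends = θends ; root = θr ; γ = γ′ ; τ = τ′ }

-- G ∧ H : identify the vertex v of G with the root r_H of H, root at r.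
-- Vertices of G are kept (↑ˡ), the non-root vertices of H are appended (↑ʳ).

module _ {nG mG k mH : ℕ} (G : Graph nG mG) (v : Fin nG) (H : Graph (suc k) mH) where
  wedgeV : Fin (suc k) → Fin (nG + k)
  wedgeV u with root H ≟ u
  ... | yes _  = v ↑ˡ k
  ... | no ne  = nG ↑ʳ punchOut ne

  wedge : Graph (nG + k) (mG + mH)
  wedge = record
    { ends = λ e → [ (λ a → map (_↑ˡ k) (_↑ˡ k) (ends G a)) , (λ b → map wedgeV wedgeV (ends H b)) ] (splitAt mG e)
    ; root = root G ↑ˡ k
    ; γ    = λ e → [ γ G , γ H ] (splitAt mG e)
    ; τ    = λ e → [ τ G , τ H ] (splitAt mG e)
    }

{-# OPTIONS --safe #-}
-- Let S be the cable-trench tree of G and T′ the part of T inside G. Both miss an edge of R₂₃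
-- and an edge of R₁₃, so in both the r–v path is R₁₂. Replacing T′ by S inside T therefore
-- leaves the r–w path of every vertex w of H unchanged, and gives a spanning tree of G ∧ H
-- of cost cost(T) − cost(T′) + cost(S). Minimality of T yields cost(T′) ≤ cost(S), so T′ is
-- a cable-trench tree of G and equals S by uniqueness.
module Submission where

open import Defs
open import Data.Nat using (ℕ; zero; suc; _+_)
open import Data.Fin using (Fin; zero; suc; _↑ˡ_; _↑ʳ_; splitAt; inject₁; _≟_)
open import Data.Fin.Properties
  using (suc-injective; ↑ˡ-injective; ↑ʳ-injective; inject₁-injective; splitAt-↑ˡ; splitAt-↑ʳ; splitAt⁻¹-↑ˡ; splitAt⁻¹-↑ʳ)
open import Data.Bool using (Bool; true; false; if_then_else_)
open import Data.Product using (Σ; ∃; ∃₂; _×_; _,_; proj₁; proj₂)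
open import Data.Sum using (_⊎_; inj₁; inj₂; [_,_])
open import Data.List using (List; []; _∷_; map; _++_; tabulate)
open import Data.List.Relation.Unary.All using (All; []; _∷_; zipWith) renaming (map to All-map)
open import Data.List.Relation.Unary.All.Properties using (All¬⇒¬Any; tabulate⁻; map⁺; ++⁺; ++⁻ʳ)
open import Data.List.Relation.Unary.Any using (here; there)
open import Data.List.Membership.Propositional using (_∈_)
open import Data.List.Relation.Unary.AllPairs using ([]; _∷_)
open import Data.List.Relation.Unary.Unique.Propositional using (Unique)
import Data.List.Relation.Unary.Unique.Propositional.Properties as Unique
open import Data.Rational using (ℚ; 0ℚ; _≤_; -_) renaming (_+_ to _+ℚ_)
import Data.Rational.Properties as ℚ
open import Algebra.Bundles using (CommutativeMonoid)
open import Algebra.Properties.CommutativeSemigroup (CommutativeMonoid.commutativeSemigroup ℚ.+-0-commutativeMonoid)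
  using (interchange)
open import Algebra.Properties.Group ℚ.+-0-group using (//-rightDividesʳ)
open import Data.Empty using (⊥; ⊥-elim)
open import Function using (_∘_)
open import Function.Bundles using (_⇔_; Equivalence)
open import Relation.Nullary using (¬_; yes; no)
open import Relation.Binary.PropositionalEquality
  using (_≡_; _≢_; refl; sym; trans; cong; cong₂; subst; subst₂; module ≡-Reasoning)

ΣFin-cong : ∀ n {f g : Fin n → ℚ} → (∀ i → f i ≡ g i) → ΣFin n f ≡ ΣFin n g
ΣFin-cong zero    _   = refl
ΣFin-cong (suc n) f≗g = cong₂ _+ℚ_ (f≗g zero) (ΣFin-cong n (f≗g ∘ suc))

ΣFin-+ : ∀ a b (f : Fin (a + b) → ℚ) →
         ΣFin (a + b) f ≡ ΣFin a (f ∘ (_↑ˡ b)) +ℚ ΣFin b (f ∘ (a ↑ʳ_))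
ΣFin-+ zero    b f = sym (ℚ.+-identityˡ _)
ΣFin-+ (suc a) b f = trans (cong (f zero +ℚ_) (ΣFin-+ a b (f ∘ suc))) (sym (ℚ.+-assoc (f zero) _ _))

ΣList-map : ∀ {A B : Set} {f : B → ℚ} {g : A → B} {h : A → ℚ} → (∀ x → f (g x) ≡ h x) →
            ∀ xs → ΣList f (map g xs) ≡ ΣList h xs
ΣList-map             _    []       = refl
ΣList-map {f = f} {g} fg≗h (x ∷ xs) = cong₂ _+ℚ_ (fg≗h x) (ΣList-map {f = f} {g} fg≗h xs)

+-cancelʳ-≤ : ∀ x {a b} → a +ℚ x ≤ b +ℚ x → a ≤ b
+-cancelʳ-≤ x a+x≤b+x =
  subst₂ _≤_ (//-rightDividesʳ x _) (//-rightDividesʳ x _) (ℚ.+-monoˡ-≤ (- x) a+x≤b+x)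

↑ˡ≢↑ʳ : ∀ {m n} (i : Fin m) (j : Fin n) → i ↑ˡ n ≢ m ↑ʳ j
↑ˡ≢↑ʳ {m} {n} i j eq with trans (sym (splitAt-↑ˡ m i n)) (trans (cong (splitAt m) eq) (splitAt-↑ʳ m n j))
... | ()

≡true⇒≢false : ∀ {b : Bool} → b ≡ true → b ≢ false
≡true⇒≢false refl ()

tailSeq-cases : ∀ {N} (u v : Fin N) p f i →
                tailSeq u v p f i ≡ v ⊎ ∃ λ j → i ≡ inject₁ j × tailSeq u v p f i ≡ f j
tailSeq-cases u v zero    f zero    = inj₁ refl
tailSeq-cases u v (suc p) f zero    = inj₂ (zero , refl , refl)
tailSeq-cases u v (suc p) f (suc i) with tailSeq-cases u v p (f ∘ suc) i
... | inj₁ at-v              = inj₁ at-v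
... | inj₂ (j , refl , at-j) = inj₂ (suc j , refl , at-j)

tailSeq-root-irrelevant : ∀ {N} (u u′ v : Fin N) p f j → tailSeq u v p f j ≡ tailSeq u′ v p f j
tailSeq-root-irrelevant u u′ v zero    f zero    = refl
tailSeq-root-irrelevant u u′ v (suc p) f zero    = refl
tailSeq-root-irrelevant u u′ v (suc p) f (suc j) = tailSeq-root-irrelevant u u′ v p (f ∘ suc) j

without-left : ∀ {m} (a b : Fin m) → without a b a ≡ false
without-left a b with a ≟ a
... | yes _  = refl
... | no a≢a = ⊥-elim (a≢a refl)

without-right : ∀ {m} (a b : Fin m) → without a b b ≡ false
without-right a b with b ≟ a
... | yes _ = refl
... | no _ with b ≟ b
...   | yes _  = refl
...   | no b≢b = ⊥-elim (b≢b refl)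

without≡false : ∀ {m} {a b x : Fin m} → without a b x ≡ false → x ≡ a ⊎ x ≡ b
without≡false {a = a} {b} {x} off with x ≟ a
... | yes x≡a = inj₁ x≡a
... | no _ with x ≟ b
...   | yes x≡b = inj₂ x≡b
...   | no _ with off
...     | ()

module _ {n m : ℕ} (Γ : Graph n m) where

  walk-first : ∀ {S x y vs es} → Walk Γ S x y vs es → x ∈ vs
  walk-first nil          = here refl
  walk-first (cons _ _ _) = here refl

  walk-last : ∀ {S x y vs es} → Walk Γ S x y vs es → y ∈ vs
  walk-last nil          = here refl
  walk-last (cons _ _ w) = there (walk-last w)

  walk-edges : ∀ {S x y vs es} → Walk Γ S x y vs es → All (λ e → S e ≡ true) es
  walk-edges nil          = []
  walk-edges (cons s _ w) = s ∷ walk-edges w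

  walk-within : ∀ {S S′ x y vs es} → Walk Γ S x y vs es → All (λ e → S′ e ≡ true) es →
                Walk Γ S′ x y vs es
  walk-within nil          []       = nil
  walk-within (cons _ j w) (s ∷ ss) = cons s j (walk-within w ss)

  closed-path-edgeless : ∀ {S x vs es} → Walk Γ S x x vs es → Unique vs → es ≡ []
  closed-path-edgeless nil          _       = refl
  closed-path-edgeless (cons _ _ w) (x∉ ∷ _) = ⊥-elim (All¬⇒¬Any x∉ (walk-last w))

  -- Forced v u x es: x was entered from u, and each vertex met before v has just one incident
  -- edge besides the one it was entered by, so every path x → v avoiding u follows es.
  data Forced (v : Fin n) : Fin n → Fin n → List (Fin m) → Set where
    arrived : ∀ {u} → Forced v u v []
    step    : ∀ {u x x′ e es} → x ≢ v →
              (∀ f z → Joins Γ f x z → z ≡ u ⊎ (f ≡ e × z ≡ x′)) →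
              Forced v x x′ es → Forced v u x (e ∷ es)

  forced-path : ∀ {v u x es S vs es′} → Forced v u x es → Walk Γ S x v vs es′ → Unique vs →
                All (u ≢_) vs → es′ ≡ es
  forced-path arrived              w            u        _        = closed-path-edgeless w u
  forced-path (step x≢v _ _)       nil          _        _        = ⊥-elim (x≢v refl)
  forced-path (step _ only forced) (cons _ j w) (x∉ ∷ u) (_ ∷ u∉) with only _ _ j
  ... | inj₁ refl          = ⊥-elim (All¬⇒¬Any u∉ (walk-first w))
  ... | inj₂ (refl , refl) = cong (_ ∷_) (forced-path forced w u x∉)

  pathSeq-forced : ∀ v p u (f : Fin p → Fin n) (h : Fin p → Fin m) → (∀ j → f j ≢ v) →
    (∀ j e z → Joins Γ e (f j) z →
       z ≡ pathSeq u v p f (inject₁ (inject₁ j)) ⊎ (e ≡ h j × z ≡ pathSeq u v p f (suc (suc j)))) →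
    Forced v u (tailSeq u v p f zero) (tabulate h)
  pathSeq-forced v zero    u f h _   _   = arrived
  pathSeq-forced v (suc p) u f h f≢v adj =
    step (f≢v zero) adj₀ (pathSeq-forced v p (f zero) (f ∘ suc) (h ∘ suc) (f≢v ∘ suc) adj₊)
    where
      reroot : ∀ i → tailSeq u v p (f ∘ suc) i ≡ tailSeq (f zero) v p (f ∘ suc) i
      reroot = tailSeq-root-irrelevant u (f zero) v p (f ∘ suc)

      adj₀ : ∀ e z → Joins Γ e (f zero) z →
             z ≡ u ⊎ (e ≡ h zero × z ≡ tailSeq (f zero) v p (f ∘ suc) zero)
      adj₀ e z J with adj zero e z J
      ... | inj₁ z≡u       = inj₁ z≡u
      ... | inj₂ (e≡ , z≡) = inj₂ (e≡ , trans z≡ (reroot zero))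

      previous : ∀ j → pathSeq u v (suc p) f (inject₁ (inject₁ (suc j)))
                     ≡ pathSeq (f zero) v p (f ∘ suc) (inject₁ (inject₁ j))
      previous zero    = refl
      previous (suc j) = reroot (inject₁ (inject₁ j))

      adj₊ : ∀ j e z → Joins Γ e (f (suc j)) z →
             z ≡ pathSeq (f zero) v p (f ∘ suc) (inject₁ (inject₁ j))
             ⊎ (e ≡ h (suc j) × z ≡ pathSeq (f zero) v p (f ∘ suc) (suc (suc j)))
      adj₊ j e z J with adj (suc j) e z J
      ... | inj₁ z≡        = inj₁ (trans z≡ (previous j))
      ... | inj₂ (e≡ , z≡) = inj₂ (e≡ , trans z≡ (reroot (suc j)))

  τCost : EdgeSet m → ℚ
  τCost S = ΣFin m (λ e → if S e then τ Γ e else 0ℚ)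

  γCost : (Fin n → List (Fin m)) → ℚ
  γCost P = ΣFin n (ΣList (γ Γ) ∘ P)

  cost : EdgeSet m → (Fin n → List (Fin m)) → ℚ
  cost S P = τCost S +ℚ γCost P

  τCost-cong : ∀ {S S′} → (∀ e → S e ≡ S′ e) → τCost S ≡ τCost S′
  τCost-cong S≗S′ = ΣFin-cong m (λ e → cong (if_then τ Γ e else 0ℚ) (S≗S′ e))

  paths⇒connected : ∀ {S} (P : Fin n → List (Fin m)) → (∀ w → Path Γ S (root Γ) w (P w)) → Connected Γ S
  paths⇒connected P paths w = proj₁ (paths w) , P w , proj₁ (proj₂ (paths w))

data Branch : Set where
  br₁ br₂ br₃ : Branch

module θGraphStructure (p₁ p₂ p₃ : ℕ) (γ τ : Fin (θE p₁ p₂ p₃) → ℚ) where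
  G : Graph (θV p₁ p₂ p₃) (θE p₁ p₂ p₃)
  G = θGraph p₁ p₂ p₃ γ τ

  r v : Fin (θV p₁ p₂ p₃)
  r = θr p₁ p₂ p₃
  v = θv p₁ p₂ p₃

  len : Branch → ℕ
  len br₁ = p₁
  len br₂ = p₂
  len br₃ = p₃

  inner : (b : Branch) → Fin (len b) → Fin (θV p₁ p₂ p₃)
  inner br₁ = int₁ p₁ p₂ p₃
  inner br₂ = int₂ p₁ p₂ p₃
  inner br₃ = int₃ p₁ p₂ p₃

  R : (b : Branch) → Fin (suc (len b)) → Fin (θE p₁ p₂ p₃)
  R br₁ = R₂₃ p₁ p₂ p₃
  R br₂ = R₁₃ p₁ p₂ p₃
  R br₃ = R₁₂ p₁ p₂ p₃

  vertex : (b : Branch) → Fin (suc (suc (len b))) → Fin (θV p₁ p₂ p₃)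
  vertex b = pathSeq r v (len b) (inner b)

  ends-R : ∀ b k → ends G (R b k) ≡ pathEdge r v (len b) (inner b) k
  ends-R br₁ k rewrite splitAt-↑ˡ (suc p₁) k (suc p₂ + suc p₃) = refl
  ends-R br₂ k rewrite splitAt-↑ʳ (suc p₁) (suc p₂ + suc p₃) (k ↑ˡ suc p₃)
                     | splitAt-↑ˡ (suc p₂) k (suc p₃) = refl
  ends-R br₃ k rewrite splitAt-↑ʳ (suc p₁) (suc p₂ + suc p₃) (suc p₂ ↑ʳ k)
                     | splitAt-↑ʳ (suc p₂) (suc p₃) k = refl

  R-surjective : ∀ e → ∃₂ λ b k → e ≡ R b k
  R-surjective e with splitAt (suc p₁) e in eq
  ... | inj₁ k = br₁ , k , sym (splitAt⁻¹-↑ˡ eq)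
  ... | inj₂ e′ with splitAt (suc p₂) e′ in eq′
  ...   | inj₁ k = br₂ , k , sym (trans (cong (suc p₁ ↑ʳ_) (splitAt⁻¹-↑ˡ eq′)) (splitAt⁻¹-↑ʳ eq))
  ...   | inj₂ k = br₃ , k , sym (trans (cong (suc p₁ ↑ʳ_) (splitAt⁻¹-↑ʳ eq′)) (splitAt⁻¹-↑ʳ eq))

  R₂₃≢R₁₃ : ∀ k k′ → R br₁ k ≢ R br₂ k′
  R₂₃≢R₁₃ k k′ = ↑ˡ≢↑ʳ k (k′ ↑ˡ suc p₃)

  R₂₃-injective : ∀ {k k′} → R br₁ k ≡ R br₁ k′ → k ≡ k′
  R₂₃-injective = ↑ˡ-injective (suc p₂ + suc p₃) _ _

  R₁₃-injective : ∀ {k k′} → R br₂ k ≡ R br₂ k′ → k ≡ k′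
  R₁₃-injective = ↑ˡ-injective (suc p₃) _ _ ∘ ↑ʳ-injective (suc p₁) _ _

  inner-injective : ∀ b j b′ j′ → inner b j ≡ inner b′ j′ →
                    _≡_ {A = Σ Branch (Fin ∘ len)} (b , j) (b′ , j′)
  inner-injective br₁ j br₁ j′ eq = cong (br₁ ,_) (↑ˡ-injective _ j j′ (suc-injective (suc-injective eq)))
  inner-injective br₁ j br₂ j′ eq = ⊥-elim (↑ˡ≢↑ʳ _ _ (suc-injective (suc-injective eq)))
  inner-injective br₁ j br₃ j′ eq = ⊥-elim (↑ˡ≢↑ʳ _ _ (suc-injective (suc-injective eq)))
  inner-injective br₂ j br₁ j′ eq = ⊥-elim (↑ˡ≢↑ʳ _ _ (sym (suc-injective (suc-injective eq))))
  inner-injective br₂ j br₂ j′ eq =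
    cong (br₂ ,_) (↑ˡ-injective _ j j′ (↑ʳ-injective p₁ _ _ (suc-injective (suc-injective eq))))
  inner-injective br₂ j br₃ j′ eq =
    ⊥-elim (↑ˡ≢↑ʳ _ _ (↑ʳ-injective p₁ _ _ (suc-injective (suc-injective eq))))
  inner-injective br₃ j br₁ j′ eq = ⊥-elim (↑ˡ≢↑ʳ _ _ (sym (suc-injective (suc-injective eq))))
  inner-injective br₃ j br₂ j′ eq =
    ⊥-elim (↑ˡ≢↑ʳ _ _ (sym (↑ʳ-injective p₁ _ _ (suc-injective (suc-injective eq)))))
  inner-injective br₃ j br₃ j′ eq =
    cong (br₃ ,_) (↑ʳ-injective p₂ _ _ (↑ʳ-injective p₁ _ _ (suc-injective (suc-injective eq))))

  inner≢r : ∀ b j → inner b j ≢ r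
  inner≢r br₁ j ()
  inner≢r br₂ j ()
  inner≢r br₃ j ()

  inner≢v : ∀ b j → inner b j ≢ v
  inner≢v br₁ j ()
  inner≢v br₂ j ()
  inner≢v br₃ j ()

  vertex≡inner : ∀ b i b′ j → vertex b i ≡ inner b′ j →
                 ∃ λ j′ → i ≡ suc (inject₁ j′) × _≡_ {A = Σ Branch (Fin ∘ len)} (b , j′) (b′ , j)
  vertex≡inner b zero    b′ j eq = ⊥-elim (inner≢r b′ j (sym eq))
  vertex≡inner b (suc i) b′ j eq with tailSeq-cases r v (len b) (inner b) i
  ... | inj₁ at-v               = ⊥-elim (inner≢v b′ j (trans (sym eq) at-v))
  ... | inj₂ (j′ , refl , at-j′) = j′ , refl , inner-injective b j′ b′ j (trans (sym at-j′) eq)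

  vertex≡r : ∀ b i → vertex b i ≡ r → i ≡ zero
  vertex≡r b zero    _  = refl
  vertex≡r b (suc i) eq with tailSeq-cases r v (len b) (inner b) i
  ... | inj₁ at-v with trans (sym at-v) eq
  ...   | ()
  vertex≡r b (suc i) eq | inj₂ (j , _ , at-j) = ⊥-elim (inner≢r b j (trans (sym at-j) eq))

  inner-adjacent : ∀ b j e z → Joins G e (inner b j) z →
    z ≡ vertex b (inject₁ (inject₁ j)) ⊎ (e ≡ R b (suc j) × z ≡ vertex b (suc (suc j)))
  inner-adjacent b j e z J with R-surjective e
  inner-adjacent b j _ z (inj₁ eq) | b′ , k , refl
    with trans (sym (ends-R b′ k)) eq
  ... | eq′ with vertex≡inner b′ (inject₁ k) b j (cong proj₁ eq′)
  ...   | _ , i≡ , refl with inject₁-injective {i = k} {j = suc j} i≡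
  ...     | refl = inj₂ (refl , sym (cong proj₂ eq′))
  inner-adjacent b j _ z (inj₂ eq) | b′ , k , refl
    with trans (sym (ends-R b′ k)) eq
  ... | eq′ with vertex≡inner b′ (suc k) b j (cong proj₂ eq′)
  ...   | _ , refl , refl = inj₁ (sym (cong proj₁ eq′))

  r-adjacent : ∀ e z → Joins G e r z → ∃ λ b → e ≡ R b zero × z ≡ vertex b (suc zero)
  r-adjacent e z J with R-surjective e
  r-adjacent _ z (inj₁ eq) | b , k , refl with trans (sym (ends-R b k)) eq
  ... | eq′ with inject₁-injective {i = k} {j = zero} (vertex≡r b (inject₁ k) (cong proj₁ eq′))
  ...   | refl = b , refl , sym (cong proj₂ eq′)
  r-adjacent _ z (inj₂ eq) | b , k , refl with vertex≡r b (suc k) (cong proj₂ (trans (sym (ends-R b k)) eq))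
  ... | ()

  branch-forced : ∀ b → Forced G v r (vertex b (suc zero)) (tabulate (R b ∘ suc))
  branch-forced b = pathSeq-forced G v (len b) r (inner b) (R b ∘ suc) (inner≢v b) (inner-adjacent b)

  r-v-path-is-R₁₂ : ∀ {S vs es} k k′ → S (R br₁ k) ≡ false → S (R br₂ k′) ≡ false →
                    Walk G S r v vs es → Unique vs → es ≡ tabulate (R br₃)
  r-v-path-is-R₁₂ {S} k k′ off₁ off₂ (cons {z = z} {e = e} s J w) (r∉ ∷ u)
    with r-adjacent e z J
  ... | b , refl , refl with forced-path G (branch-forced b) w u r∉
  ...   | refl = along b (walk-edges G (cons s J w))
    where
      along : ∀ b → All (λ e → S e ≡ true) (tabulate (R b)) →
              R b zero ∷ tabulate (R b ∘ suc) ≡ tabulate (R br₃)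
      along br₁ on = ⊥-elim (≡true⇒≢false (tabulate⁻ {f = R br₁} on k) off₁)
      along br₂ on = ⊥-elim (≡true⇒≢false (tabulate⁻ {f = R br₂} on k′) off₂)
      along br₃ _  = refl

  r-v-path-edges-in : ∀ {S S′ es es′} k k′ l l′ →
    S (R br₁ k) ≡ false → S (R br₂ k′) ≡ false → Path G S r v es →
    S′ (R br₁ l) ≡ false → S′ (R br₂ l′) ≡ false → Path G S′ r v es′ → All (λ a → S a ≡ true) es′
  r-v-path-edges-in k k′ l l′ off₁ off₂ (_ , w , u) off₁′ off₂′ (_ , w′ , u′)
    rewrite r-v-path-is-R₁₂ l l′ off₁′ off₂′ w′ u′ =
    subst (All _) (r-v-path-is-R₁₂ k k′ off₁ off₂ w u) (walk-edges G w)

  R₂₃-R₁₃-pair-determined : ∀ {k k′ l l′} →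
    (∀ {e} → e ≡ R br₁ l ⊎ e ≡ R br₂ l′ → e ≡ R br₁ k ⊎ e ≡ R br₂ k′) → l ≡ k × l′ ≡ k′
  R₂₃-R₁₃-pair-determined {k} {k′} {l} {l′} l,l′⊆k,k′ = first , second
    where
      first : l ≡ k
      first with l,l′⊆k,k′ (inj₁ refl)
      ... | inj₁ eq = R₂₃-injective eq
      ... | inj₂ eq = ⊥-elim (R₂₃≢R₁₃ l k′ eq)

      second : l′ ≡ k′
      second with l,l′⊆k,k′ (inj₂ refl)
      ... | inj₁ eq = ⊥-elim (R₂₃≢R₁₃ k l′ (sym eq))
      ... | inj₂ eq = R₁₃-injective eq

module WedgeStructure {nG mG k mH : ℕ} (G : Graph nG mG) (v : Fin nG) (H : Graph (suc k) mH) where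

  W : Graph (nG + k) (mG + mH)
  W = wedge G v H

  vtxG : Fin nG → Fin (nG + k)
  vtxG x = x ↑ˡ k

  vtxH : Fin k → Fin (nG + k)
  vtxH j = nG ↑ʳ j

  edgeG : Fin mG → Fin (mG + mH)
  edgeG a = a ↑ˡ mH

  edgeH : Fin mH → Fin (mG + mH)
  edgeH b = mG ↑ʳ b

  _↾G : EdgeSet (mG + mH) → EdgeSet mG
  (T ↾G) a = T (edgeG a)

  GVertex HVertex HSide : Fin (nG + k) → Set
  GVertex x = ∃ λ x′ → x ≡ vtxG x′
  HVertex x = ∃ λ j → x ≡ vtxH j
  HSide x   = x ≡ vtxG v ⊎ HVertex x

  HEdge : Fin (mG + mH) → Set
  HEdge e = ∃ λ b → e ≡ edgeH b

  GVertex∧HVertex⇒⊥ : ∀ {x} → GVertex x → HVertex x → ⊥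
  GVertex∧HVertex⇒⊥ (x′ , refl) (j , eq) = ↑ˡ≢↑ʳ x′ j eq

  vertex-cases : ∀ x → GVertex x ⊎ HVertex x
  vertex-cases x with splitAt nG x in eq
  ... | inj₁ x′ = inj₁ (x′ , sym (splitAt⁻¹-↑ˡ eq))
  ... | inj₂ j  = inj₂ (j , sym (splitAt⁻¹-↑ʳ eq))

  edge-cases : ∀ e → (∃ λ a → e ≡ edgeG a) ⊎ HEdge e
  edge-cases e with splitAt mG e in eq
  ... | inj₁ a = inj₁ (a , sym (splitAt⁻¹-↑ˡ eq))
  ... | inj₂ b = inj₂ (b , sym (splitAt⁻¹-↑ʳ eq))

  ends-edgeG : ∀ a → ends W (edgeG a) ≡ (vtxG (proj₁ (ends G a)) , vtxG (proj₂ (ends G a)))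
  ends-edgeG a rewrite splitAt-↑ˡ mG a mH = refl

  ends-edgeH : ∀ b → ends W (edgeH b) ≡ (wedgeV G v H (proj₁ (ends H b)) , wedgeV G v H (proj₂ (ends H b)))
  ends-edgeH b rewrite splitAt-↑ʳ mG mH b = refl

  wedgeV-HSide : ∀ u → HSide (wedgeV G v H u)
  wedgeV-HSide u with root H ≟ u
  ... | yes _ = inj₁ refl
  ... | no _  = inj₂ (_ , refl)

  joins-edgeG : ∀ {a x z} → Joins W (edgeG a) x z →
                ∃₂ λ x′ z′ → x ≡ vtxG x′ × z ≡ vtxG z′ × Joins G a x′ z′
  joins-edgeG {a} (inj₁ eq) with trans (sym (ends-edgeG a)) eq
  ... | refl = _ , _ , refl , refl , inj₁ refl
  joins-edgeG {a} (inj₂ eq) with trans (sym (ends-edgeG a)) eq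
  ... | refl = _ , _ , refl , refl , inj₂ refl

  joins-edgeH : ∀ {b x z} → Joins W (edgeH b) x z → HSide x × HSide z
  joins-edgeH {b} (inj₁ eq) with trans (sym (ends-edgeH b)) eq
  ... | refl = wedgeV-HSide _ , wedgeV-HSide _
  joins-edgeH {b} (inj₂ eq) with trans (sym (ends-edgeH b)) eq
  ... | refl = wedgeV-HSide _ , wedgeV-HSide _

  joins-lift : ∀ {a x z} → Joins G a x z → Joins W (edgeG a) (vtxG x) (vtxG z)
  joins-lift {a} (inj₁ eq) = inj₁ (trans (ends-edgeG a) (cong (λ (x , z) → vtxG x , vtxG z) eq))
  joins-lift {a} (inj₂ eq) = inj₂ (trans (ends-edgeG a) (cong (λ (x , z) → vtxG x , vtxG z) eq))

  lift-walk : ∀ {S S′ x y vs es} → Walk G S x y vs es → (∀ a → S a ≡ true → S′ (edgeG a) ≡ true) →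
              Walk W S′ (vtxG x) (vtxG y) (map vtxG vs) (map edgeG es)
  lift-walk nil          _    = nil
  lift-walk (cons s J w) S⊆S′ = cons (S⊆S′ _ s) (joins-lift J) (lift-walk w S⊆S′)

  lift-path : ∀ {S T x y es} → Path G S x y es → (∀ a → S a ≡ true → T (edgeG a) ≡ true) →
              Path W T (vtxG x) (vtxG y) (map edgeG es)
  lift-path (vs , w , u) S⊆T = map vtxG vs , lift-walk w S⊆T , Unique.map⁺ (↑ˡ-injective k _ _) u

  lift-cycle : ∀ {S S′} → (∀ a → S a ≡ true → S′ (edgeG a) ≡ true) → Cycle G S → Cycle W S′
  lift-cycle S⊆S′ (x , vs , e , es , w , uv , ue) =
    vtxG x , map vtxG vs , edgeG e , map edgeG es , lift-walk w S⊆S′ ,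
    Unique.map⁺ (↑ˡ-injective k _ _) uv , Unique.map⁺ (↑ˡ-injective mH _ _) ue

  H→G-walk-visits-v : ∀ {S x y vs es} → Walk W S x y vs es → HVertex x → GVertex y → vtxG v ∈ vs
  H→G-walk-visits-v nil hx gy = ⊥-elim (GVertex∧HVertex⇒⊥ gy hx)
  H→G-walk-visits-v (cons {e = e} s J w) hx gy with edge-cases e
  ... | inj₁ (a , refl) with joins-edgeG J
  ...   | _ , _ , x≡ , _ , _ = ⊥-elim (GVertex∧HVertex⇒⊥ (_ , x≡) hx)
  H→G-walk-visits-v (cons {e = e} s J w) hx gy | inj₂ (b , refl) with joins-edgeH J
  ...   | _ , inj₁ z≡v = there (subst (_∈ _) z≡v (walk-first W w))
  ...   | _ , inj₂ hz  = there (H→G-walk-visits-v w hz gy)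

  G→H-walk-visits-v : ∀ {S x y vs es} → Walk W S x y vs es → GVertex x → HSide y → vtxG v ∈ vs
  G→H-walk-visits-v nil gx (inj₁ refl) = here refl
  G→H-walk-visits-v nil gx (inj₂ hy)   = ⊥-elim (GVertex∧HVertex⇒⊥ gx hy)
  G→H-walk-visits-v (cons {e = e} s J w) gx hy with edge-cases e
  ... | inj₁ (a , refl) with joins-edgeG J
  ...   | _ , _ , _ , z≡ , _ = there (G→H-walk-visits-v w (_ , z≡) hy)
  G→H-walk-visits-v (cons {e = e} s J w) gx hy | inj₂ (b , refl) with joins-edgeH J
  ...   | inj₁ x≡v , _ = here (sym x≡v)
  ...   | inj₂ hx  , _ = ⊥-elim (GVertex∧HVertex⇒⊥ gx hx)

  HSide-path-edges : ∀ {S x y vs es} → Walk W S x y vs es → Unique vs → HSide x → HSide y → All HEdge es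
  HSide-path-edges nil _ _ _ = []
  HSide-path-edges (cons {e = e} s J w) (x∉ ∷ u) hx hy with edge-cases e
  ... | inj₂ (b , refl) = (b , refl) ∷ HSide-path-edges w u (proj₂ (joins-edgeH J)) hy
  ... | inj₁ (a , refl) with joins-edgeG J | hx
  ...   | x′ , _ , x≡ , _ , _ | inj₂ h     = ⊥-elim (GVertex∧HVertex⇒⊥ (x′ , x≡) h)
  ...   | _ , z′ , _ , z≡ , _ | inj₁ refl = ⊥-elim (All¬⇒¬Any x∉ (G→H-walk-visits-v w (z′ , z≡) hy))

  restrict-path : ∀ {S x y vs es} x′ y′ → Walk W S x y vs es → Unique vs → x ≡ vtxG x′ → y ≡ vtxG y′ →
                  ∃₂ λ vsG esG → Walk G (S ↾G) x′ y′ vsG esG × vs ≡ map vtxG vsG × es ≡ map edgeG esG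
  restrict-path x′ y′ nil _ refl y≡ with ↑ˡ-injective k _ _ y≡
  ... | refl = _ , _ , nil , refl , refl
  restrict-path x′ y′ (cons {e = e} s J w) (x∉ ∷ u) x≡ y≡ with edge-cases e
  ... | inj₁ (a , refl) with joins-edgeG J
  ...   | _ , z′ , x≡′ , z≡ , J′ with ↑ˡ-injective k _ _ (trans (sym x≡) x≡′)
  ...     | refl with restrict-path z′ y′ w u z≡ y≡
  ...       | _ , _ , wG , refl , refl = _ , _ , cons s J′ wG , cong (_∷ _) x≡ , refl
  restrict-path x′ y′ (cons {e = e} s J w) (x∉ ∷ u) refl y≡ | inj₂ (b , refl) with joins-edgeH J
  ... | inj₂ hx    , _        = ⊥-elim (GVertex∧HVertex⇒⊥ (x′ , refl) hx)
  ... | inj₁ x≡v , inj₁ z≡v =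
    ⊥-elim (All¬⇒¬Any x∉ (subst (_∈ _) (trans z≡v (sym x≡v)) (walk-first W w)))
  ... | inj₁ x≡v , inj₂ hz  =
    ⊥-elim (All¬⇒¬Any x∉ (subst (_∈ _) (sym x≡v) (H→G-walk-visits-v w hz (y′ , y≡))))

  -- The membership component carries uniqueness of vsG through the induction.
  split-at-v : ∀ {S x y vs es} x′ → Walk W S x y vs es → Unique vs → x ≡ vtxG x′ → HVertex y →
    ∃₂ λ vsG esG → ∃ λ es₂ → (Walk G (S ↾G) x′ v vsG esG × Unique vsG) ×
      All (λ u → vtxG u ∈ vs) vsG × All HEdge es₂ × es ≡ map edgeG esG ++ es₂
  split-at-v x′ w u x≡ hy with x′ ≟ v
  split-at-v _ w u refl hy | yes refl =
    _ , [] , _ , (nil , [] ∷ []) , walk-first W w ∷ [] , HSide-path-edges w u (inj₁ refl) (inj₂ hy) , refl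
  split-at-v x′ nil u refl hy | no _ = ⊥-elim (GVertex∧HVertex⇒⊥ (x′ , refl) hy)
  split-at-v x′ (cons {e = e} s J w) (x∉ ∷ u) x≡ hy | no x′≢v with edge-cases e
  ... | inj₂ (b , refl) with joins-edgeH J
  ...   | inj₁ x≡v , _ = ⊥-elim (x′≢v (↑ˡ-injective k _ _ (trans (sym x≡) x≡v)))
  ...   | inj₂ hx  , _ = ⊥-elim (GVertex∧HVertex⇒⊥ (x′ , x≡) hx)
  split-at-v x′ (cons {e = e} s J w) (x∉ ∷ u) x≡ hy | no x′≢v | inj₁ (a , refl) with joins-edgeG J
  ... | _ , z′ , x≡′ , z≡ , J′ with ↑ˡ-injective k _ _ (trans (sym x≡) x≡′)
  ...   | refl with split-at-v z′ w u z≡ hy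
  ...     | _ , _ , _ , (wG , uG) , in-vs , h-edges , refl =
    _ , _ , _ , (cons s J′ wG , All-map x′≢ in-vs ∷ uG) , here (sym x≡) ∷ All-map there in-vs , h-edges , refl
    where
      x′≢ : ∀ {t} → vtxG t ∈ _ → x′ ≢ t
      x′≢ t∈ refl = All¬⇒¬Any x∉ (subst (_∈ _) (sym x≡) t∈)

  path-to-H-via-v : ∀ {S x′ j es} → Path W S (vtxG x′) (vtxH j) es →
                    ∃₂ λ esG es₂ → Path G (S ↾G) x′ v esG × All HEdge es₂ × es ≡ map edgeG esG ++ es₂
  path-to-H-via-v (_ , w , u) with split-at-v _ w u refl (_ , refl)
  ... | vsG , esG , es₂ , (wG , uG) , _ , h-edges , eq = esG , es₂ , (vsG , wG , uG) , h-edges , eq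

  acyclic-by-parts : ∀ {S T : EdgeSet (mG + mH)} {SG : EdgeSet mG} →
    (∀ a → S (edgeG a) ≡ true → SG a ≡ true) → ¬ Cycle G SG →
    (∀ b → S (edgeH b) ≡ true → T (edgeH b) ≡ true) → ¬ Cycle W T → ¬ Cycle W S
  acyclic-by-parts {T = T} S⊆SG acycG S⊆T acycT (x , vs , e , es , cons s J w , uv , ue)
    with edge-cases e
  ... | inj₁ (a , refl) with joins-edgeG J
  ...   | x′ , z′ , x≡ , z≡ , J′ with restrict-path z′ x′ w uv z≡ x≡
  ...     | vsG , esG , wG , refl , refl =
    acycG (x′ , vsG , a , esG , cons (S⊆SG a s) J′ (walk-within G wG (All-map (S⊆SG _) (walk-edges G wG))) ,
           Unique.map⁻ uv , Unique.map⁻ {xs = a ∷ esG} ue)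
  acyclic-by-parts {T = T} S⊆SG acycG S⊆T acycT (x , vs , e , es , cons s J w , uv , ue)
      | inj₂ (b , refl) =
    acycT (x , vs , e , es , walk-within W (cons s J w) on-T , uv , ue)
    where
      on-T : All (λ e → T e ≡ true) (edgeH b ∷ es)
      on-T = zipWith (λ { ((b′ , refl) , s′) → S⊆T b′ s′ })
               ((b , refl) ∷ HSide-path-edges w uv (proj₂ (joins-edgeH J)) (proj₁ (joins-edgeH J)) ,
                walk-edges W (cons s J w))

  τ-edgeG : ∀ a → τ W (edgeG a) ≡ τ G a
  τ-edgeG a rewrite splitAt-↑ˡ mG a mH = refl

  τ-edgeH : ∀ b → τ W (edgeH b) ≡ τ H b
  τ-edgeH b rewrite splitAt-↑ʳ mG mH b = refl

  γ-edgeG : ∀ a → γ W (edgeG a) ≡ γ G a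
  γ-edgeG a rewrite splitAt-↑ˡ mG a mH = refl

  costH : EdgeSet (mG + mH) → (Fin (nG + k) → List (Fin (mG + mH))) → ℚ
  costH T P = ΣFin mH (λ b → if T (edgeH b) then τ H b else 0ℚ) +ℚ ΣFin k (ΣList (γ W) ∘ P ∘ vtxH)

  cost-wedge : ∀ T P (PG : Fin nG → List (Fin mG)) → (∀ w → P (vtxG w) ≡ map edgeG (PG w)) →
               cost W T P ≡ cost G (T ↾G) PG +ℚ costH T P
  cost-wedge T P PG P≡ = begin
    τCost W T +ℚ γCost W P                        ≡⟨ cong₂ _+ℚ_ τ-split γ-split ⟩
    (τCost G (T ↾G) +ℚ τH) +ℚ (γCost G PG +ℚ γH)  ≡⟨ interchange (τCost G (T ↾G)) τH (γCost G PG) γH ⟩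
    cost G (T ↾G) PG +ℚ costH T P                 ∎
    where
      open ≡-Reasoning
      τH γH : ℚ
      τH = ΣFin mH (λ b → if T (edgeH b) then τ H b else 0ℚ)
      γH = ΣFin k (ΣList (γ W) ∘ P ∘ vtxH)

      τ-split : τCost W T ≡ τCost G (T ↾G) +ℚ τH
      τ-split = trans (ΣFin-+ mG mH _) (cong₂ _+ℚ_
        (ΣFin-cong mG (λ a → cong (if T (edgeG a) then_else 0ℚ) (τ-edgeG a)))
        (ΣFin-cong mH (λ b → cong (if T (edgeH b) then_else 0ℚ) (τ-edgeH b))))

      γ-split : γCost W P ≡ γCost G PG +ℚ γH
      γ-split = trans (ΣFin-+ nG k _) (cong (_+ℚ γH)
        (ΣFin-cong nG (λ w → trans (cong (ΣList (γ W)) (P≡ w)) (ΣList-map {f = γ W} {g = edgeG} γ-edgeG (PG w)))))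

  graft : EdgeSet mG → EdgeSet (mG + mH) → EdgeSet (mG + mH)
  graft S T e = [ S , T ∘ edgeH ] (splitAt mG e)

  graft-edgeG : ∀ S T a → graft S T (edgeG a) ≡ S a
  graft-edgeG S T a rewrite splitAt-↑ˡ mG a mH = refl

  graft-edgeH : ∀ S T b → graft S T (edgeH b) ≡ T (edgeH b)
  graft-edgeH S T b rewrite splitAt-↑ʳ mG mH b = refl

  graftPaths : (Fin nG → List (Fin mG)) → (Fin (nG + k) → List (Fin (mG + mH))) →
               Fin (nG + k) → List (Fin (mG + mH))
  graftPaths PS P x = [ map edgeG ∘ PS , P ∘ vtxH ] (splitAt nG x)

  graftPaths-vtxG : ∀ PS P w → graftPaths PS P (vtxG w) ≡ map edgeG (PS w)
  graftPaths-vtxG PS P w rewrite splitAt-↑ˡ nG w k = refl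

  graftPaths-vtxH : ∀ PS P j → graftPaths PS P (vtxH j) ≡ P (vtxH j)
  graftPaths-vtxH PS P j rewrite splitAt-↑ʳ nG k j = refl

  cost-graft : ∀ S T PS P → cost W (graft S T) (graftPaths PS P) ≡ cost G S PS +ℚ costH T P
  cost-graft S T PS P =
    trans (cost-wedge (graft S T) (graftPaths PS P) PS (graftPaths-vtxG PS P))
          (cong₂ _+ℚ_ (cong (_+ℚ γCost G PS) (τCost-cong G (graft-edgeG S T)))
                      (cong₂ _+ℚ_ (ΣFin-cong mH (λ b → cong (if_then τ H b else 0ℚ) (graft-edgeH S T b)))
                                  (ΣFin-cong k (λ j → cong (ΣList (γ W)) (graftPaths-vtxH PS P j)))))

  graft-path-to-H : ∀ {S T x′ j es} → Path W T (vtxG x′) (vtxH j) es →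
    (∀ {esG} → Path G (T ↾G) x′ v esG → All (λ a → S a ≡ true) esG) →
    Path W (graft S T) (vtxG x′) (vtxH j) es
  graft-path-to-H {S} {T} (vs , w , u) x′-v-in-S with path-to-H-via-v (vs , w , u)
  ... | esG , es₂ , pG , h-edges , refl = vs , walk-within W w (++⁺ G-part H-part) , u
    where
      G-part : All (λ e → graft S T e ≡ true) (map edgeG esG)
      G-part = map⁺ (All-map (λ {a} s → trans (graft-edgeG S T a) s) (x′-v-in-S pG))
      H-part : All (λ e → graft S T e ≡ true) es₂
      H-part = zipWith (λ { ((b , refl) , t) → trans (graft-edgeH S T b) t })
                       (h-edges , ++⁻ʳ (map edgeG esG) (walk-edges W w))

  module Exchange {T : EdgeSet (mG + mH)} {P : Fin (nG + k) → List (Fin (mG + mH))}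
                  (T-paths : ∀ x → Path W T (vtxG (root G)) x (P x)) where

    restricted : ∀ w → ∃ λ esG → Path G (T ↾G) (root G) w esG × P (vtxG w) ≡ map edgeG esG
    restricted w with T-paths (vtxG w)
    ... | _ , wk , u with restrict-path (root G) w wk u refl refl
    ...   | vsG , esG , wG , refl , P≡ = esG , (vsG , wG , Unique.map⁻ u) , P≡

    PG : Fin nG → List (Fin mG)
    PG = proj₁ ∘ restricted

    restrict-paths : ∀ w → Path G (T ↾G) (root G) w (PG w)
    restrict-paths = proj₁ ∘ proj₂ ∘ restricted

    restrict-spanningTree : ¬ Cycle W T → SpanningTree G (T ↾G)
    restrict-spanningTree acyc = paths⇒connected G PG restrict-paths , acyc ∘ lift-cycle (λ _ s → s)

    cost-restrict : cost W T P ≡ cost G (T ↾G) PG +ℚ costH T P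
    cost-restrict = cost-wedge T P PG (proj₂ ∘ proj₂ ∘ restricted)

    module _ {S : EdgeSet mG} {PS : Fin nG → List (Fin mG)} (S-paths : ∀ w → Path G S (root G) w (PS w))
             (root-v-in-S : ∀ {es} → Path G (T ↾G) (root G) v es → All (λ a → S a ≡ true) es) where

      graft-paths : ∀ x → Path W (graft S T) (vtxG (root G)) x (graftPaths PS P x)
      graft-paths x with vertex-cases x
      ... | inj₁ (w , refl) = subst (Path W (graft S T) _ (vtxG w)) (sym (graftPaths-vtxG PS P w))
                                    (lift-path (S-paths w) (λ a s → trans (graft-edgeG S T a) s))
      ... | inj₂ (j , refl) = subst (Path W (graft S T) _ (vtxH j)) (sym (graftPaths-vtxH PS P j))
                                    (graft-path-to-H (T-paths (vtxH j)) root-v-in-S)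

      graft-spanningTree : ¬ Cycle G S → ¬ Cycle W T → SpanningTree W (graft S T)
      graft-spanningTree acycS acycT =
        paths⇒connected W (graftPaths PS P) graft-paths ,
        acyclic-by-parts (λ a s → trans (sym (graft-edgeG S T a)) s) acycS
                         (λ b s → trans (sym (graft-edgeH S T b)) s) acycT

  restrict-cableTrench : ∀ {T S} → CableTrench W T → CableTrench G S →
    (∀ {es} → Path G (T ↾G) (root G) v es → All (λ a → S a ≡ true) es) → CableTrench G (T ↾G)
  restrict-cableTrench {T} {S} ((_ , acycT) , _ , (P , T-paths , refl) , T-min)
                               ((_ , acycS) , _ , (PS , S-paths , refl) , S-min) root-v-in-S =
    restrict-spanningTree acycT , cost G (T ↾G) PG , (PG , restrict-paths , refl) ,
    λ T′ c′ st ic → ℚ.≤-trans restrict≤S (S-min T′ c′ st ic)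
    where
      open Exchange T-paths
      restrict≤S : cost G (T ↾G) PG ≤ cost G S PS
      restrict≤S = +-cancelʳ-≤ (costH T P)
        (subst₂ _≤_ cost-restrict (cost-graft S T PS P)
          (T-min (graft S T) _ (graft-spanningTree S-paths root-v-in-S acycS acycT)
                 (graftPaths PS P , graft-paths S-paths root-v-in-S , refl)))

lemma7 : (p₁ p₂ p₃ : ℕ) (γG τG : Fin (θE p₁ p₂ p₃) → ℚ)
    (e₁ : Fin (suc p₁)) (e₂ : Fin (suc p₂)) →
    UniqueCableTrench (θGraph p₁ p₂ p₃ γG τG) (without (R₂₃ p₁ p₂ p₃ e₁) (R₁₃ p₁ p₂ p₃ e₂)) →
    (k mH : ℕ) (H : Graph (suc k) mH) →
    (T : EdgeSet (θE p₁ p₂ p₃ + mH)) →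
    CableTrench (wedge (θGraph p₁ p₂ p₃ γG τG) (θv p₁ p₂ p₃) H) T →
    (e₁′ : Fin (suc p₁)) (e₂′ : Fin (suc p₂)) →
    (∀ (e : Fin (θE p₁ p₂ p₃)) → (T (e ↑ˡ mH) ≡ false) ⇔ (e ≡ R₂₃ p₁ p₂ p₃ e₁′ ⊎ e ≡ R₁₃ p₁ p₂ p₃ e₂′)) →
    e₁′ ≡ e₁ × e₂′ ≡ e₂
lemma7 p₁ p₂ p₃ γG τG e₁ e₂ (S-ct@(_ , _ , (_ , S-paths , _) , _) , S-unique) k mH H T T-ct e₁′ e₂′
       T-missing =
  R₂₃-R₁₃-pair-determined deleted
  where
    open θGraphStructure p₁ p₂ p₃ γG τG
    open WedgeStructure G v H

    S : EdgeSet (θE p₁ p₂ p₃)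
    S = without (R br₁ e₁) (R br₂ e₂)

    T↾G-off : ∀ {e} → e ≡ R br₁ e₁′ ⊎ e ≡ R br₂ e₂′ → (T ↾G) e ≡ false
    T↾G-off = Equivalence.from (T-missing _)

    r-v-in-S : ∀ {es} → Path G (T ↾G) r v es → All (λ a → S a ≡ true) es
    r-v-in-S = r-v-path-edges-in e₁ e₂ e₁′ e₂′
                 (without-left (R br₁ e₁) (R br₂ e₂)) (without-right (R br₁ e₁) (R br₂ e₂)) (S-paths v)
                 (T↾G-off (inj₁ refl)) (T↾G-off (inj₂ refl))

    T↾G≡S : ∀ e → (T ↾G) e ≡ S e
    T↾G≡S = S-unique (T ↾G) (restrict-cableTrench T-ct S-ct r-v-in-S)

    deleted : ∀ {e} → e ≡ R br₁ e₁′ ⊎ e ≡ R br₂ e₂′ → e ≡ R br₁ e₁ ⊎ e ≡ R br₂ e₂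
    deleted e-off = without≡false (trans (sym (T↾G≡S _)) (T↾G-off e-off))
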